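{- For every set of formulas $\Gamma$ and formula $\phi$: if $\Gamma\vdash_{\mathbf{VC}}\phi$, then $\Gamma\models_{\mathbf{VC}}\phi$.
   Context: Formulas are built from propositional variables and $\bot$ using $\lnot,\supset,\land,\lor$ and a binary operator: if $\phi,\psi$ are formulas, so is $\Box_\phi\psi$. Abbreviations: $\top:=\lnot\bot$, $\Diamond_\phi\psi:=\lnot\Box_\phi\lnot\psi$. A Segerberg model $M=\langle U,P,R,V\rangle$ has a nonempty set $U$, a set $P\subseteq\wp(U)$ with $\emptyset,U\in P$, closed under complement, intersection, union, and such that $S,T\in P$ implies $\{x\in U: R_S(x)\subseteq T\}\in P$; a map $R$ assigning to each $S\in P$ a relation $R_S\subseteq U\times U$ (write $R_S(x)=\{y: xR_Sy\}$); and $V$ mapping propositional variables into $P$. Truth: $x\not\models\bot$; $x\models p$ iff $x\in V(p)$; usual clauses for $\land,\lor,\supset,\lnot$; $x\models\Box_\phi\psi$ iff every $y$ with $xR_{[\phi]}y$ satisfies $\psi$, where $[\phi]=\{x: M,x\models\phi\}$. A $\mathbf{VC}$-model is a Segerberg model such that for all $S,T\in P$, $x\in U$: (1) $R_S(x)\subseteq S$; (2) $R_S(x)\cap T\neq\emptyset\Rightarrow R_T(x)\neq\emptyset$; (3) $R_U(x)\subseteq\{x\}$; (4) $x\in R_U(x)$; (5) $R_S(x)\cap T\subseteq R_{S\cap T}(x)$; (6) $R_S(x)\cap T\neq\emptyset\Rightarrow R_{S\cap T}(x)\subseteq R_S(x)\cap T$. $\Gamma\models_{\mathbf{VC}}\phi$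 means: for every $\mathbf{VC}$-model $M$ and world $x$, if all formulas of $\Gamma$ are true at $x$, then $\phi$ is true at $x$. Prefixed formulas are $i\triangleright\phi$ and $i\,r_\phi\,j$ ($i,j$ positive integers). $\mathbf{VC}$ tableau rules (premises $\Rightarrow$ conclusions; "$|$" separates branches): $i\triangleright\phi\land\psi\Rightarrow i\triangleright\phi,\ i\triangleright\psi$; $i\triangleright\lnot(\phi\land\psi)\Rightarrow i\triangleright\lnot\phi\ |\ i\triangleright\lnot\psi$; $i\triangleright\phi\lor\psi\Rightarrow i\triangleright\phi\ |\ i\triangleright\psi$; $i\triangleright\lnot(\phi\lor\psi)\Rightarrow i\triangleright\lnot\phi,\ i\triangleright\lnot\psi$; $i\triangleright\phi\supset\psi\Rightarrow i\triangleright\lnot\phi\ |\ i\triangleright\psi$; $i\triangleright\lnot(\phi\supset\psi)\Rightarrow i\triangleright\phi,\ i\triangleright\lnot\psi$; $i\triangleright\lnot\lnot\phi\Rightarrow i\triangleright\phi$; ($\Box$) $i\triangleright\Box_\phi\psi$ and $i\,r_\phi\,j\Rightarrow j\triangleright\psi$; ($\lnot\Box$) $i\triangleright\lnot\Box_\phi\psi\Rightarrow i\,r_\phi\,j,\ j\triangleright\lnot\psi$, $j$ new to the branch; ($\Diamond$) $i\triangleright\Diamond_\phi\psi\Rightarrow i\,r_\phi\,j,\ j\triangleright\psi$, $j$ new; ($\lnot\Diamond$) $i\triangleright\lnot\Diamond_\phi\psi$ and $i\,r_\phi\,j\Rightarrow j\triangleright\lnot\psi$; (cut) no premises $\Rightarrow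 i\triangleright\phi\ |\ i\triangleright\lnot\phi$, $i$ already on the branch; (ea) $i\,r_\phi\,j\Rightarrow(k\triangleright\lnot\phi,\ k\triangleright\psi)\ |\ (k\triangleright\phi,\ k\triangleright\lnot\psi)\ |\ i\,r_\psi\,j$, any $\psi$, $k$ new; (R1) $i\,r_\phi\,j\Rightarrow j\triangleright\phi$; (R2) $j\triangleright\psi$, $i\,r_\phi\,j\Rightarrow i\,r_\psi\,k$, $k$ new; (R3) $i\triangleright\phi$, $j\triangleright\lnot\phi$, $i\,r_\top\,j\Rightarrow j\triangleright\phi$; (R4) no premises $\Rightarrow i\,r_\top\,i$, $i$ on the branch; (R5) $j\triangleright\psi$, $i\,r_\phi\,j\Rightarrow i\,r_{\phi\land\psi}\,j$; (R6) $j\triangleright\psi$, $i\,r_\phi\,j$, $i\,r_{\phi\land\psi}\,k\Rightarrow k\triangleright\psi,\ i\,r_\phi\,k$. A tableau is a downward-branching tree of prefixed formulas each an assumption or a conclusion of a rule applied to formulas above it on its branch (conclusions of a branching rule as siblings); a branch is closed if it contains $i\triangleright\theta$ and $i\triangleright\lnot\theta$, or $i\triangleright\bot$; the tableau is closed if all branches are. $\Gamma\vdash_{\mathbf{VC}}\phi$ means there is a closed $\mathbf{VC}$-tableau with assumptions $\{1\triangleright\psi:\psi\in\Gamma\}\cup\{1\triangleright\lnot\phi\}$. -}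

module Defs where

open import Data.Nat using (ℕ; _≤_)
open import Data.Empty using (⊥)
open import Data.Unit using (⊤)
open import Data.Product using (Σ; ∃; _×_; _,_)
open import Data.Sum using (_⊎_)
open import Data.List using (List; []; _∷_)
open import Data.List.Membership.Propositional using (_∈_)
open import Data.List.Relation.Unary.Any using (Any)
open import Relation.Nullary using (¬_)
open import Relation.Binary.PropositionalEquality using (_≡_)

infixr 10 _⊃_
infixr 12 _∨_
infixr 14 _∧_
infix 16 □⟨_⟩_ ◇⟨_⟩_

data Formula : Set where
  var   : ℕ → Formula
  bot   : Formula
  neg   : Formula → Formula
  _⊃_   : Formula → Formula → Formula
  _∧_   : Formula → Formula → Formula
  _∨_   : Formula → Formula → Formula
  □⟨_⟩_ : Formula → Formula → Formula

top : Formula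
top = neg bot

◇⟨_⟩_ : Formula → Formula → Formula
◇⟨ φ ⟩ ψ = neg (□⟨ φ ⟩ (neg ψ))

Subset : Set → Set₁
Subset U = U → Set

module _ {U : Set} where
  ∅ˢ : Subset U
  ∅ˢ _ = ⊥

  Fullˢ : Subset U
  Fullˢ _ = ⊤

  ∁ˢ : Subset U → Subset U
  ∁ˢ S x = ¬ S x

  _∩ˢ_ : Subset U → Subset U → Subset U
  (S ∩ˢ T) x = S x × T x

  _∪ˢ_ : Subset U → Subset U → Subset U
  (S ∪ˢ T) x = S x ⊎ T x

  _≐_ : Subset U → Subset U → Set
  S ≐ T = ∀ x → (S x → T x) × (T x → S x)

record SegerbergModel : Set₁ where
  field
    U     : Set
    point : U                                   -- U is nonempty
    P     : Subset U → Set
    R     : Subset U → U → U → Set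
    V     : ℕ → Subset U
    -- P is a family of sets: membership respects extensional equality,
    -- and so does the assignment S ↦ R_S.
    P-ext : ∀ {S T} → S ≐ T → P S → P T
    R-ext : ∀ {S T} → S ≐ T → ∀ x y → R S x y → R T x y
    P-∅   : P ∅ˢ
    P-U   : P Fullˢ
    P-∁   : ∀ {S} → P S → P (∁ˢ S)
    P-∩   : ∀ {S T} → P S → P T → P (S ∩ˢ T)
    P-∪   : ∀ {S T} → P S → P T → P (S ∪ˢ T)
    P-□   : ∀ {S T} → P S → P T → P (λ x → ∀ y → R S x y → T y)
    V-P   : ∀ p → P (V p)

module _ (M : SegerbergModel) where
  open SegerbergModel M

  _⊨_ : U → Formula → Set
  x ⊨ var p     = V p x
  x ⊨ bot       = ⊥
  x ⊨ neg φ     = ¬ (x ⊨ φ)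
  x ⊨ (φ ⊃ ψ)   = x ⊨ φ → x ⊨ ψ
  x ⊨ (φ ∧ ψ)   = (x ⊨ φ) × (x ⊨ ψ)
  x ⊨ (φ ∨ ψ)   = (x ⊨ φ) ⊎ (x ⊨ ψ)
  x ⊨ (□⟨ φ ⟩ ψ) = ∀ y → R (λ z → z ⊨ φ) x y → y ⊨ ψ

  ⟦_⟧ : Formula → Subset U
  ⟦ φ ⟧ x = x ⊨ φ

record IsVC (M : SegerbergModel) : Set₁ where
  open SegerbergModel M
  field
    vc1 : ∀ {S} → P S → ∀ x y → R S x y → S y
    vc2 : ∀ {S T} → P S → P T → ∀ x →
          (∃ λ y → R S x y × T y) → ∃ λ z → R T x z
    vc3 : ∀ x y → R Fullˢ x y → y ≡ x
    vc4 : ∀ x → R Fullˢ x x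
    vc5 : ∀ {S T} → P S → P T → ∀ x y → R S x y → T y → R (S ∩ˢ T) x y
    vc6 : ∀ {S T} → P S → P T → ∀ x →
          (∃ λ y → R S x y × T y) →
          ∀ z → R (S ∩ˢ T) x z → R S x z × T z

record VCModel : Set₁ where
  field
    model : SegerbergModel
    isVC  : IsVC model
  open SegerbergModel model public

_⊨VC_ : (Formula → Set) → Formula → Set₁
Γ ⊨VC φ = ∀ (M : VCModel) (x : VCModel.U M) →
          (∀ ψ → Γ ψ → _⊨_ (VCModel.model M) x ψ) →
          _⊨_ (VCModel.model M) x φ

infix 5 _▷_
infix 5 _r⟨_⟩_

data PFormula : Set where
  _▷_     : ℕ → Formula → PFormula
  _r⟨_⟩_  : ℕ → Formula → ℕ → PFormula

Branch : Set
Branch = List PFormula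

data Occurs (i : ℕ) : PFormula → Set where
  occ▷  : ∀ {φ} → Occurs i (i ▷ φ)
  occrˡ : ∀ {φ j} → Occurs i (i r⟨ φ ⟩ j)
  occrʳ : ∀ {φ j} → Occurs i (j r⟨ φ ⟩ i)

OnBranch : ℕ → Branch → Set
OnBranch i b = Any (Occurs i) b

Fresh : ℕ → Branch → Set
Fresh j b = (1 ≤ j) × ¬ OnBranch j b

-- Closed Γ b : the branch b (read bottom-up, newest formula first) can be
-- extended to a closed VC-tableau, where at any point one may add an
-- assumption 1 ▷ ψ with ψ ∈ Γ.
data Closed (Γ : Formula → Set) : Branch → Set where
  clash  : ∀ {b i θ} → (i ▷ θ) ∈ b → (i ▷ neg θ) ∈ b → Closed Γ b
  clash⊥ : ∀ {b i} → (i ▷ bot) ∈ b → Closed Γ b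
  assm   : ∀ {b ψ} → Γ ψ → Closed Γ ((1 ▷ ψ) ∷ b) → Closed Γ b
  r∧     : ∀ {b i φ ψ} → (i ▷ (φ ∧ ψ)) ∈ b →
           Closed Γ ((i ▷ ψ) ∷ (i ▷ φ) ∷ b) → Closed Γ b
  r¬∧    : ∀ {b i φ ψ} → (i ▷ neg (φ ∧ ψ)) ∈ b →
           Closed Γ ((i ▷ neg φ) ∷ b) → Closed Γ ((i ▷ neg ψ) ∷ b) → Closed Γ b
  r∨     : ∀ {b i φ ψ} → (i ▷ (φ ∨ ψ)) ∈ b →
           Closed Γ ((i ▷ φ) ∷ b) → Closed Γ ((i ▷ ψ) ∷ b) → Closed Γ b
  r¬∨    : ∀ {b i φ ψ} → (i ▷ neg (φ ∨ ψ)) ∈ b →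
           Closed Γ ((i ▷ neg ψ) ∷ (i ▷ neg φ) ∷ b) → Closed Γ b
  r⊃     : ∀ {b i φ ψ} → (i ▷ (φ ⊃ ψ)) ∈ b →
           Closed Γ ((i ▷ neg φ) ∷ b) → Closed Γ ((i ▷ ψ) ∷ b) → Closed Γ b
  r¬⊃    : ∀ {b i φ ψ} → (i ▷ neg (φ ⊃ ψ)) ∈ b →
           Closed Γ ((i ▷ neg ψ) ∷ (i ▷ φ) ∷ b) → Closed Γ b
  r¬¬    : ∀ {b i φ} → (i ▷ neg (neg φ)) ∈ b →
           Closed Γ ((i ▷ φ) ∷ b) → Closed Γ b
  r□     : ∀ {b i j φ ψ} → (i ▷ □⟨ φ ⟩ ψ) ∈ b → (i r⟨ φ ⟩ j) ∈ b →
           Closed Γ ((j ▷ ψ) ∷ b) → Closed Γ b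
  r¬□    : ∀ {b i φ ψ} j → (i ▷ neg (□⟨ φ ⟩ ψ)) ∈ b → Fresh j b →
           Closed Γ ((j ▷ neg ψ) ∷ (i r⟨ φ ⟩ j) ∷ b) → Closed Γ b
  r◇     : ∀ {b i φ ψ} j → (i ▷ ◇⟨ φ ⟩ ψ) ∈ b → Fresh j b →
           Closed Γ ((j ▷ ψ) ∷ (i r⟨ φ ⟩ j) ∷ b) → Closed Γ b
  r¬◇    : ∀ {b i j φ ψ} → (i ▷ neg (◇⟨ φ ⟩ ψ)) ∈ b → (i r⟨ φ ⟩ j) ∈ b →
           Closed Γ ((j ▷ neg ψ) ∷ b) → Closed Γ b
  cut    : ∀ {b} i φ → OnBranch i b →
           Closed Γ ((i ▷ φ) ∷ b) → Closed Γ ((i ▷ neg φ) ∷ b) → Closed Γ b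
  ea     : ∀ {b i j φ} ψ k → (i r⟨ φ ⟩ j) ∈ b → Fresh k b →
           Closed Γ ((k ▷ ψ) ∷ (k ▷ neg φ) ∷ b) →
           Closed Γ ((k ▷ neg ψ) ∷ (k ▷ φ) ∷ b) →
           Closed Γ ((i r⟨ ψ ⟩ j) ∷ b) → Closed Γ b
  R1     : ∀ {b i j φ} → (i r⟨ φ ⟩ j) ∈ b →
           Closed Γ ((j ▷ φ) ∷ b) → Closed Γ b
  R2     : ∀ {b i j φ ψ} k → (j ▷ ψ) ∈ b → (i r⟨ φ ⟩ j) ∈ b → Fresh k b →
           Closed Γ ((i r⟨ ψ ⟩ k) ∷ b) → Closed Γ b
  R3     : ∀ {b i j φ} → (i ▷ φ) ∈ b → (j ▷ neg φ) ∈ b → (i r⟨ top ⟩ j) ∈ b →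
           Closed Γ ((j ▷ φ) ∷ b) → Closed Γ b
  R4     : ∀ {b} i → OnBranch i b →
           Closed Γ ((i r⟨ top ⟩ i) ∷ b) → Closed Γ b
  R5     : ∀ {b i j φ ψ} → (j ▷ ψ) ∈ b → (i r⟨ φ ⟩ j) ∈ b →
           Closed Γ ((i r⟨ φ ∧ ψ ⟩ j) ∷ b) → Closed Γ b
  R6     : ∀ {b i j k φ ψ} → (j ▷ ψ) ∈ b → (i r⟨ φ ⟩ j) ∈ b →
           (i r⟨ φ ∧ ψ ⟩ k) ∈ b →
           Closed Γ ((i r⟨ φ ⟩ k) ∷ (k ▷ ψ) ∷ b) → Closed Γ b

_⊢VC_ : (Formula → Set) → Formula → Set
Γ ⊢VC φ = Closed Γ ((1 ▷ neg φ) ∷ [])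

module Submission where

-- Suppose Γ ⊢VC φ but some world x of a VC-model satisfies Γ and ¬φ.
-- A branch b is *realized* by an assignment f of worlds to prefixes if
-- the prefix 1 occurs on b, Γ holds at f 1, and every entry of b holds
-- under f (i ▷ θ: θ is true at f i; i r⟨ θ ⟩ j: f i R_[θ] f j).  The
-- key fact is local soundness of every rule: if the premises of a rule
-- are realized by f, then one of its conclusion branches is realized by
-- f, or by f updated at the new prefix (which does not disturb the old
-- entries because the prefix is fresh).  The structural rules R1–R6 are
-- exactly the VC frame conditions (1)–(6), and (ea) is the dichotomy
-- "[φ] and [ψ] differ at some world, or R_[φ] = R_[ψ]".  Induction on
-- the closed tableau then shows that no closed branch is realizable; the
-- initial branch 1 ▷ ¬φ is realized by the constant assignment at x.
-- The argument is classical: excluded middle is needed for the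
-- branching rules, for ¬□/◇ and (ea), and for [φ ⊃ ψ] ∈ P.

open import Defs
open import Level using (0ℓ)
open import Axiom.ExcludedMiddle using (ExcludedMiddle)
open import Axiom.DoubleNegationElimination using (em⇒dne)
open import Data.Nat using (ℕ; _≟_)
open import Data.Empty using (⊥-elim)
open import Data.Unit using (tt)
open import Data.Product using (∃; _×_; _,_)
open import Data.Sum using (_⊎_; inj₁; inj₂)
open import Data.List using (_∷_)
open import Data.List.Membership.Propositional using (_∈_)
open import Data.List.Relation.Unary.Any using (here; there)
open import Data.List.Relation.Unary.All using (All; []; _∷_; lookup)
open import Relation.Nullary using (¬_; yes; no)
open import Relation.Binary.PropositionalEquality
  using (_≡_; _≢_; refl; sym; subst; subst₂)

module _ {W : Set} where

  _[_↦_] : (ℕ → W) → ℕ → W → ℕ → W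
  (f [ j ↦ y ]) n with n ≟ j
  ... | yes _ = y
  ... | no _  = f n

  update-here : ∀ f j (y : W) → (f [ j ↦ y ]) j ≡ y
  update-here f j y with j ≟ j
  ... | yes _  = refl
  ... | no j≢j = ⊥-elim (j≢j refl)

  update-elsewhere : ∀ f j (y : W) {n} → n ≢ j → (f [ j ↦ y ]) n ≡ f n
  update-elsewhere f j y {n} n≢j with n ≟ j
  ... | yes n≡j = ⊥-elim (n≢j n≡j)
  ... | no _    = refl

occurs-on-branch : ∀ {n pf b} → pf ∈ b → Occurs n pf → OnBranch n b
occurs-on-branch (here refl) o = here o
occurs-on-branch (there m)   o = there (occurs-on-branch m o)

on-branch-not-fresh : ∀ {b n j} → OnBranch n b → ¬ OnBranch j b → n ≢ j
on-branch-not-fresh on fresh refl = fresh on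

module Classical (em : ExcludedMiddle 0ℓ) where

  dne : {A : Set} → ¬ ¬ A → A
  dne = em⇒dne em

  ¬∀⇒∃¬ : {W : Set} {Rel B : W → Set} →
          ¬ (∀ y → Rel y → B y) → ∃ λ y → Rel y × ¬ B y
  ¬∀⇒∃¬ ¬all =
    dne λ ¬ex → ¬all λ y r → dne λ ¬b → ¬ex (y , r , ¬b)

  separate-or-equal : {W : Set} (S T : Subset W) →
    (∃ λ z → ¬ S z × T z) ⊎ (∃ λ z → S z × ¬ T z) ⊎ S ≐ T
  separate-or-equal S T with em {∃ λ z → ¬ S z × T z}
                           | em {∃ λ z → S z × ¬ T z}
  ... | yes sep | _       = inj₁ sep
  ... | no _    | yes sep = inj₂ (inj₁ sep)
  ... | no ¬sep | no ¬sep′ = inj₂ (inj₂ λ z →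
          (λ s → dne λ ¬t → ¬sep′ (z , s , ¬t))
        , (λ t → dne λ ¬s → ¬sep (z , ¬s , t)))

module Soundness (em : ExcludedMiddle 0ℓ) (Γ : Formula → Set) (M : VCModel) where
  open Classical em
  open VCModel M
  open IsVC isVC

  _⊩_ : U → Formula → Set
  x ⊩ φ = _⊨_ model x φ

  [_] : Formula → Subset U
  [ φ ] x = x ⊩ φ

  -- Every truth set belongs to P, so the frame conditions apply to it.
  truth-set-in-P : ∀ φ → P [ φ ]
  truth-set-in-P (var p)    = V-P p
  truth-set-in-P bot        = P-ext (λ _ → (λ ()) , (λ ())) P-∅
  truth-set-in-P (neg φ)    = P-∁ (truth-set-in-P φ)
  truth-set-in-P (φ ⊃ ψ)    =
    P-ext implication (P-∪ (P-∁ (truth-set-in-P φ)) (truth-set-in-P ψ))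
    where
    implication : (∁ˢ [ φ ] ∪ˢ [ ψ ]) ≐ [ φ ⊃ ψ ]
    implication x = (λ { (inj₁ ¬a) a → ⊥-elim (¬a a) ; (inj₂ b) _ → b })
                  , λ a→b → case (em {x ⊩ φ}) a→b
      where
      case : _ → (x ⊩ φ → x ⊩ ψ) → ¬ (x ⊩ φ) ⊎ x ⊩ ψ
      case (yes a) a→b = inj₂ (a→b a)
      case (no ¬a) _   = inj₁ ¬a
  truth-set-in-P (φ ∧ ψ)    = P-∩ (truth-set-in-P φ) (truth-set-in-P ψ)
  truth-set-in-P (φ ∨ ψ)    = P-∪ (truth-set-in-P φ) (truth-set-in-P ψ)
  truth-set-in-P (□⟨ φ ⟩ ψ) = P-□ (truth-set-in-P φ) (truth-set-in-P ψ)

  R-top⇒R-full : ∀ {x y} → R [ top ] x y → R Fullˢ x y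
  R-top⇒R-full = R-ext (λ _ → (λ _ → tt) , (λ _ ())) _ _

  R-full⇒R-top : ∀ {x y} → R Fullˢ x y → R [ top ] x y
  R-full⇒R-top = R-ext (λ _ → (λ _ ()) , (λ _ → tt)) _ _

  Sat : (ℕ → U) → PFormula → Set
  Sat f (i ▷ φ)      = f i ⊩ φ
  Sat f (i r⟨ φ ⟩ j) = R [ φ ] (f i) (f j)

  sat-agree : ∀ {f g} pf → (∀ n → Occurs n pf → g n ≡ f n) → Sat f pf → Sat g pf
  sat-agree (i ▷ φ)      same s = subst (_⊩ φ) (sym (same i occ▷)) s
  sat-agree (i r⟨ φ ⟩ j) same s =
    subst₂ (R [ φ ]) (sym (same i occrˡ)) (sym (same j occrʳ)) s

  record Realizes (f : ℕ → U) (b : Branch) : Set where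
    constructor realizes
    field
      root-on-branch : OnBranch 1 b
      Γ-at-root      : ∀ ψ → Γ ψ → f 1 ⊩ ψ
      entries-hold   : All (Sat f) b
  open Realizes

  push : ∀ {f b pf} → Sat f pf → Realizes f b → Realizes f (pf ∷ b)
  push s (realizes on γ hold) = realizes (there on) γ (s ∷ hold)

  _∋_ : ∀ {f b pf} → Realizes f b → pf ∈ b → Sat f pf
  ρ ∋ m = lookup (entries-hold ρ) m

  realizes-update : ∀ {f b j} y → ¬ OnBranch j b → Realizes f b → Realizes (f [ j ↦ y ]) b
  realizes-update {f} {j = j} y fresh (realizes on γ hold) =
    realizes on
      (λ ψ g → subst (_⊩ ψ) (sym (update-elsewhere f j y (on-branch-not-fresh on fresh))) (γ ψ g))
      (update-all fresh hold)
    where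
    update-all : ∀ {b} → ¬ OnBranch j b → All (Sat f) b → All (Sat (f [ j ↦ y ])) b
    update-all fresh′ [] = []
    update-all fresh′ (_∷_ {x = pf} s ss) =
      sat-agree pf (λ n o → update-elsewhere f j y
                              (on-branch-not-fresh (here o) fresh′)) s
      ∷ update-all (λ on → fresh′ (there on)) ss

  push-world : ∀ {f b j y φ} → y ⊩ φ →
               Realizes (f [ j ↦ y ]) b → Realizes (f [ j ↦ y ]) ((j ▷ φ) ∷ b)
  push-world {f} {j = j} {y} {φ} a =
    push (subst (_⊩ φ) (sym (update-here f j y)) a)

  push-edge : ∀ {f b i j y φ} → OnBranch i b → ¬ OnBranch j b → R [ φ ] (f i) y →
              Realizes (f [ j ↦ y ]) b → Realizes (f [ j ↦ y ]) ((i r⟨ φ ⟩ j) ∷ b)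
  push-edge {f} {i = i} {j} {y} {φ} on fresh r =
    push (subst₂ (R [ φ ]) (sym (update-elsewhere f j y (on-branch-not-fresh on fresh)))
                           (sym (update-here f j y)) r)

  successor : ∀ {f b i j y φ χ θ} → (i ▷ θ) ∈ b → Fresh j b → Realizes f b →
              R [ φ ] (f i) y → y ⊩ χ →
              Realizes (f [ j ↦ y ]) ((j ▷ χ) ∷ (i r⟨ φ ⟩ j) ∷ b)
  successor {y = y} m (_ , fresh) ρ r c =
    push-world c
      (push-edge (occurs-on-branch m occ▷) fresh r (realizes-update y fresh ρ))

  closed-unrealizable : ∀ {b} → Closed Γ b → ∀ f → ¬ Realizes f b
  closed-unrealizable (clash m m′) f ρ = (ρ ∋ m′) (ρ ∋ m)
  closed-unrealizable (clash⊥ m)   f ρ = ρ ∋ m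
  closed-unrealizable (assm γ c)   f ρ =
    closed-unrealizable c f (push (Γ-at-root ρ _ γ) ρ)
  closed-unrealizable (r∧ m c) f ρ with ρ ∋ m
  ... | a , b = closed-unrealizable c f (push b (push a ρ))
  closed-unrealizable (r¬∧ {i = i} {φ} m c₁ c₂) f ρ with em {f i ⊩ φ}
  ... | yes a = closed-unrealizable c₂ f (push (λ b → (ρ ∋ m) (a , b)) ρ)
  ... | no ¬a = closed-unrealizable c₁ f (push ¬a ρ)
  closed-unrealizable (r∨ m c₁ c₂) f ρ with ρ ∋ m
  ... | inj₁ a = closed-unrealizable c₁ f (push a ρ)
  ... | inj₂ b = closed-unrealizable c₂ f (push b ρ)
  closed-unrealizable (r¬∨ m c) f ρ =
    closed-unrealizable c f
      (push (λ b → (ρ ∋ m) (inj₂ b)) (push (λ a → (ρ ∋ m) (inj₁ a)) ρ))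
  closed-unrealizable (r⊃ {i = i} {φ} m c₁ c₂) f ρ with em {f i ⊩ φ}
  ... | yes a = closed-unrealizable c₂ f (push ((ρ ∋ m) a) ρ)
  ... | no ¬a = closed-unrealizable c₁ f (push ¬a ρ)
  closed-unrealizable (r¬⊃ m c) f ρ =
    closed-unrealizable c f
      (push (λ b → (ρ ∋ m) (λ _ → b))
        (push (dne λ ¬a → (ρ ∋ m) (λ a → ⊥-elim (¬a a))) ρ))
  closed-unrealizable (r¬¬ m c) f ρ = closed-unrealizable c f (push (dne (ρ ∋ m)) ρ)
  closed-unrealizable (r□ {j = j} m m′ c) f ρ =
    closed-unrealizable c f (push ((ρ ∋ m) (f j) (ρ ∋ m′)) ρ)
  closed-unrealizable (r¬□ j m fresh c) f ρ with ¬∀⇒∃¬ (ρ ∋ m)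
  ... | y , r , ¬ψ = closed-unrealizable c _ (successor m fresh ρ r ¬ψ)
  closed-unrealizable (r◇ j m fresh c) f ρ with ¬∀⇒∃¬ (ρ ∋ m)
  ... | y , r , ¬¬ψ = closed-unrealizable c _ (successor m fresh ρ r (dne ¬¬ψ))
  closed-unrealizable (r¬◇ {j = j} m m′ c) f ρ =
    closed-unrealizable c f (push (dne (ρ ∋ m) (f j) (ρ ∋ m′)) ρ)
  closed-unrealizable (cut i φ _ c₁ c₂) f ρ with em {f i ⊩ φ}
  ... | yes a = closed-unrealizable c₁ f (push a ρ)
  ... | no ¬a = closed-unrealizable c₂ f (push ¬a ρ)
  closed-unrealizable (ea {φ = φ} ψ k m (_ , fresh) c₁ c₂ c₃) f ρ
    with separate-or-equal [ φ ] [ ψ ]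
  ... | inj₁ (z , ¬a , b) =
    closed-unrealizable c₁ _ (push-world b (push-world ¬a (realizes-update z fresh ρ)))
  ... | inj₂ (inj₁ (z , a , ¬b)) =
    closed-unrealizable c₂ _ (push-world ¬b (push-world a (realizes-update z fresh ρ)))
  ... | inj₂ (inj₂ same) = closed-unrealizable c₃ f (push (R-ext same _ _ (ρ ∋ m)) ρ)
  closed-unrealizable (R1 {i = i} {j} {φ} m c) f ρ =
    closed-unrealizable c f (push (vc1 (truth-set-in-P φ) (f i) (f j) (ρ ∋ m)) ρ)
  closed-unrealizable (R2 {i = i} {j} {φ} {ψ} k m m′ (_ , fresh) c) f ρ
    with vc2 (truth-set-in-P φ) (truth-set-in-P ψ) (f i) (f j , ρ ∋ m′ , ρ ∋ m)
  ... | z , r = closed-unrealizable c _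
    (push-edge (occurs-on-branch m′ occrˡ) fresh r (realizes-update z fresh ρ))
  closed-unrealizable (R3 {i = i} {j} {φ} m m′ m″ c) f ρ =
    closed-unrealizable c f (push (subst (_⊩ φ) (sym j-is-i) (ρ ∋ m)) ρ)
    where
    j-is-i : f j ≡ f i
    j-is-i = vc3 (f i) (f j) (R-top⇒R-full (ρ ∋ m″))
  closed-unrealizable (R4 i _ c) f ρ =
    closed-unrealizable c f (push (R-full⇒R-top (vc4 (f i))) ρ)
  closed-unrealizable (R5 {i = i} {j} {φ} {ψ} m m′ c) f ρ =
    closed-unrealizable c f
      (push (vc5 (truth-set-in-P φ) (truth-set-in-P ψ) (f i) (f j) (ρ ∋ m′) (ρ ∋ m)) ρ)
  closed-unrealizable (R6 {i = i} {j} {k} {φ} {ψ} m m′ m″ c) f ρ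
    with vc6 (truth-set-in-P φ) (truth-set-in-P ψ) (f i) (f j , ρ ∋ m′ , ρ ∋ m) (f k) (ρ ∋ m″)
  ... | r , b = closed-unrealizable c f (push r (push b ρ))

  tableau-sound : ∀ {φ} → Γ ⊢VC φ → ∀ x → (∀ ψ → Γ ψ → x ⊩ ψ) → x ⊩ φ
  tableau-sound c x Γ-at-x = dne λ ¬φ →
    closed-unrealizable c (λ _ → x) (realizes (here occ▷) Γ-at-x (¬φ ∷ []))

corollary3 : ExcludedMiddle 0ℓ →
    ∀ (Γ : Formula → Set) (φ : Formula) → Γ ⊢VC φ → Γ ⊨VC φ
corollary3 em Γ φ c M = Soundness.tableau-sound em Γ M c
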